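{- Let $G$ be a connected graph and let $k$ be a positive integer such that $k\ge \mathrm{ola}^+(G)$. Then for every optimal linear arrangement $\alpha$ of $G$ and every $k$-separating bridge $e$ of $G$, the two connected components of $G-e$ are $\alpha$-comparable.
   Context: A linear arrangement of $G=(V,E)$ is a bijection $\alpha:V\to\{1,\dots,|V|\}$; net cost $\mathrm{nc}(\alpha,G)=\sum_{uv\in E}(|\alpha(u)-\alpha(v)|-1)$; $\mathrm{ola}^+(G)$ is the minimum net cost, and $\alpha$ is optimal if it attains the minimum cost $\sum_{uv\in E}|\alpha(u)-\alpha(v)|$ (equivalently the minimum net cost). A bridge is an edge $e$ such that $G-e$ has more components than $G$; a bridge $e$ of a connected graph is $k$-separating if both components of $G-e$ have more than $k$ vertices. Two disjoint subgraphs $A,B$ are $\alpha$-comparable if either $\alpha(a)<\alpha(b)$ for all $a\in V(A),b\in V(B)$, or $\alpha(a)>\alpha(b)$ for all $a\in V(A),b\in V(B)$. -}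

module Defs where

open import Data.Nat using (ℕ; zero; suc; _+_; _∸_; _≤_; _<_; ∣_-_∣)
open import Data.Fin using (Fin; toℕ) renaming (_<_ to _<ᶠ_; _≟_ to _≟ᶠ_)
import Data.Fin.Properties as FinP
open import Data.Bool using (Bool; true; false; _∧_; _∨_; not; if_then_else_)
open import Data.List using (List; map; allFin)
open import Data.Nat.ListAction using (sum)
open import Data.Product using (Σ; ∃; _×_; _,_)
open import Data.Sum using (_⊎_)
open import Relation.Nullary using (¬_)
open import Relation.Nullary.Decidable using (⌊_⌋)
open import Relation.Binary.PropositionalEquality using (_≡_)
open import Function.Bundles using (_⤖_; Bijection)
open import Function.Definitions using (Injective)

record Graph (n : ℕ) : Set where
  field
    adj    : Fin n → Fin n → Bool
    adj-sym : ∀ u v → adj u v ≡ adj v u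
    adj-irrefl : ∀ u → adj u u ≡ false
open Graph public

removeEdge : ∀ {n} → Graph n → Fin n → Fin n → Graph n
removeEdge {n} G x y = record
  { adj = a
  ; adj-sym = sym'
  ; adj-irrefl = irr
  }
  where
    isE : Fin n → Fin n → Bool
    isE u v = (⌊ u ≟ᶠ x ⌋ ∧ ⌊ v ≟ᶠ y ⌋) ∨ (⌊ u ≟ᶠ y ⌋ ∧ ⌊ v ≟ᶠ x ⌋)
    a : Fin n → Fin n → Bool
    a u v = adj G u v ∧ not (isE u v)
    open import Relation.Binary.PropositionalEquality using (cong₂; refl)
    open import Data.Bool.Properties using (∨-comm)
    isE-sym : ∀ u v → isE u v ≡ isE v u
    isE-sym u v with u ≟ᶠ x | v ≟ᶠ y | u ≟ᶠ y | v ≟ᶠ x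
    ... | p | q | r | s with ⌊ p ⌋ | ⌊ q ⌋ | ⌊ r ⌋ | ⌊ s ⌋
    ... | true  | true  | true  | true  = refl
    ... | true  | true  | true  | false = refl
    ... | true  | true  | false | true  = refl
    ... | true  | true  | false | false = refl
    ... | true  | false | true  | true  = refl
    ... | true  | false | true  | false = refl
    ... | true  | false | false | true  = refl
    ... | true  | false | false | false = refl
    ... | false | true  | true  | true  = refl
    ... | false | true  | true  | false = refl
    ... | false | true  | false | true  = refl
    ... | false | true  | false | false = refl
    ... | false | false | true  | true  = refl
    ... | false | false | true  | false = refl
    ... | false | false | false | true  = refl
    ... | false | false | false | false = refl
    sym' : ∀ u v → a u v ≡ a v u
    sym' u v = cong₂ (λ p q → p ∧ not q) (adj-sym G u v) (isE-sym' u v)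
      where
        isE-sym' : ∀ u v → isE u v ≡ isE v u
        isE-sym' = isE-sym
    irr : ∀ u → a u u ≡ false
    irr u rewrite adj-irrefl G u = refl

data Reach {n : ℕ} (G : Graph n) : Fin n → Fin n → Set where
  here : ∀ {u} → Reach G u u
  step : ∀ {u w v} → adj G u w ≡ true → Reach G w v → Reach G u v

Connected : ∀ {n} → Graph n → Set
Connected G = ∀ u v → Reach G u v

-- A linear arrangement: a bijection from vertices to positions
-- (positions 0..n-1 instead of 1..n; only differences matter).
Arrangement : ℕ → Set
Arrangement n = Fin n ⤖ Fin n

pos : ∀ {n} → Arrangement n → Fin n → ℕ
pos α u = toℕ (Bijection.to α u)

edgeSum : ∀ {n} → Graph n → (Fin n → Fin n → ℕ) → ℕ
edgeSum {n} G f =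
  sum (map (λ u → sum (map (λ v →
    if ⌊ FinP._<?_ u v ⌋ ∧ adj G u v then f u v else 0) (allFin n))) (allFin n))

cost : ∀ {n} → Arrangement n → Graph n → ℕ
cost α G = edgeSum G (λ u v → ∣ pos α u - pos α v ∣)

netCost : ∀ {n} → Arrangement n → Graph n → ℕ
netCost α G = edgeSum G (λ u v → ∣ pos α u - pos α v ∣ ∸ 1)

Optimal : ∀ {n} → Graph n → Arrangement n → Set
Optimal {n} G α = ∀ (β : Arrangement n) → cost α G ≤ cost β G

IsOlaPlus : ∀ {n} → Graph n → ℕ → Set
IsOlaPlus {n} G m =
  (Σ (Arrangement n) λ β → netCost β G ≡ m) × (∀ (β : Arrangement n) → m ≤ netCost β G)

-- e = xy is a bridge of the connected graph G: removing it disconnects G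
-- (for connected G, "more components than G" = "not connected").
Bridge : ∀ {n} → Graph n → Fin n → Fin n → Set
Bridge G x y = (adj G x y ≡ true) × ¬ Connected (removeEdge G x y)

MoreThan : ∀ {n} → ℕ → (Fin n → Set) → Set
MoreThan {n} k P = Σ (Fin (suc k) → Fin n) λ f → Injective _≡_ _≡_ f × (∀ i → P (f i))

KSeparatingBridge : ∀ {n} → ℕ → Graph n → Fin n → Fin n → Set
KSeparatingBridge k G x y =
  Bridge G x y
  × MoreThan k (Reach (removeEdge G x y) x)
  × MoreThan k (Reach (removeEdge G x y) y)

Comparable : ∀ {n} → Arrangement n → (Fin n → Set) → (Fin n → Set) → Set
Comparable α A B =
  (∀ a b → A a → B b → pos α a < pos α b)
  ⊎ (∀ a b → A a → B b → pos α b < pos α a)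

{-# OPTIONS --safe #-}
module Submission where

-- The bridge xy splits G into two sides, x's and y's, each connected in G - xy and joined only by
-- xy. An edge inside a side jumps a position if the position lies strictly between its ends and
-- holds a vertex of the other side; the total number J of jumps is at most the net cost of α.
-- If the first and the last vertex of α lie on the same side, a walk inside that side from one to
-- the other jumps every vertex of the other side, so J > k ≥ ola⁺(G) = nc(α), which is impossible.
-- Otherwise, say the first vertex is on x's side and the last on y's. If a vertex of y's side
-- precedes one of x's side, regroup α into x's side followed by y's side, each in the old order.
-- An edge inside a side shrinks by the number of positions it jumps, while the bridge grows by
-- less than J, since walks from the first vertex and to the last one jump every position it gains.
-- So the regrouped arrangement is cheaper, contradicting optimality.

open import Defs
open import Data.Bool as Bool using (Bool; true; false; _∧_; not; if_then_else_)
open import Data.Bool.Properties using (∧-zeroʳ; ∧-identityʳ; ∨-zeroʳ; not-¬; ¬-not; not-involutive)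
open import Data.Empty using (⊥; ⊥-elim)
open import Data.Fin as Fin using (Fin; zero; suc; toℕ; fromℕ<; punchOut)
import Data.Fin.Properties as Finₚ
open import Data.List using (map; allFin; tabulate)
import Data.List.Properties as Listₚ
open import Data.Nat
import Data.Nat.ListAction as List
open import Data.Nat.Properties
open import Data.Product using (∃; _×_; _,_; proj₁; proj₂)
open import Data.Sum using (_⊎_; inj₁; inj₂; swap; [_,_]′)
open import Function using (_∘_; id)
open import Function.Bundles using (Bijection; Surjection; mk⤖)
open import Function.Definitions using (Injective; StrictlySurjective)
open import Level using (0ℓ)
open import Relation.Binary using (Tri; tri<; tri≈; tri>)
open import Relation.Binary.PropositionalEquality hiding ([_])
open import Relation.Nullary using (¬_; Dec; yes; no; does; ¬?; contradiction)
open import Relation.Nullary.Decidable using (⌊_⌋; _×-dec_; _⊎-dec_; dec-true; dec-false)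
open import Relation.Unary using (Pred; Decidable; _⊆_)
open import Algebra.Properties.CommutativeMonoid.Sum +-0-commutativeMonoid
  using (sum-syntax; sum-cong-≗; sum-remove; sum-replicate-zero; ∑-distrib-+; ∑-comm)
open import Algebra.Properties.CommutativeSemigroup +-commutativeSemigroup
  using (x∙yz≈xz∙y; x∙yz≈z∙yx; x∙yz≈yx∙z; xy∙z≈y∙zx) renaming (interchange to +-interchange)

∑-mono-≤ : ∀ {n} {f g : Fin n → ℕ} → (∀ i → f i ≤ g i) → ∑[ i < n ] f i ≤ ∑[ i < n ] g i
∑-mono-≤ {zero}  f≤g = z≤n
∑-mono-≤ {suc n} f≤g = +-mono-≤ (f≤g zero) (∑-mono-≤ (f≤g ∘ suc))

≤-∑ : ∀ {n} (f : Fin n → ℕ) i → f i ≤ ∑[ j < n ] f j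
≤-∑ {suc n} f i = ≤-trans (m≤m+n (f i) _) (≤-reflexive (sym (sum-remove f)))

∑-zero : ∀ {n} {f : Fin n → ℕ} → (∀ i → f i ≡ 0) → ∑[ i < n ] f i ≡ 0
∑-zero {n} f≡0 = trans (sum-cong-≗ f≡0) (sum-replicate-zero n)

∑-single : ∀ {n} (f : Fin n → ℕ) i → (∀ j → j ≢ i → f j ≡ 0) → ∑[ j < n ] f j ≡ f i
∑-single {suc n} f i others =
  trans (sum-remove f) (trans (cong (f i +_) (∑-zero (λ j → others _ (Finₚ.punchInᵢ≢i i j)))) (+-identityʳ (f i)))

∑-indicator : ∀ {n} (j : Fin n) a → ∑[ i < n ] (if does (i Fin.≟ j) then a else 0) ≡ a
∑-indicator j a = trans (∑-single _ j (λ i i≢j → cong (λ b → if b then a else 0) (dec-false (i Fin.≟ j) i≢j)))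
                        (cong (λ b → if b then a else 0) (dec-true (j Fin.≟ j) refl))

𝟙 : ∀ {a} {A : Set a} → Dec A → ℕ
𝟙 d = if does d then 1 else 0

1≤𝟙 : ∀ {a} {A : Set a} (d : Dec A) → A → 1 ≤ 𝟙 d
1≤𝟙 d x = ≤-reflexive (cong (λ b → if b then 1 else 0) (sym (dec-true d x)))

module _ {n : ℕ} where

  count : {P : Pred (Fin n) 0ℓ} → Decidable P → ℕ
  count P? = ∑[ i < n ] 𝟙 (P? i)

  module _ {P Q R : Pred (Fin n) 0ℓ} (P? : Decidable P) (Q? : Decidable Q) (R? : Decidable R) where

    count-disjoint : (∀ {i} → P i → Q i → ⊥) → (∀ {i} → P i ⊎ Q i → R i) → count P? + count Q? ≤ count R?
    count-disjoint disjoint ∪⊆R = begin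
      count P? + count Q?            ≡⟨ ∑-distrib-+ (𝟙 ∘ P?) (𝟙 ∘ Q?) ⟨
      ∑[ i < n ] (𝟙 (P? i) + 𝟙 (Q? i)) ≤⟨ ∑-mono-≤ pointwise ⟩
      count R?                       ∎
      where
      open ≤-Reasoning
      pointwise : ∀ i → 𝟙 (P? i) + 𝟙 (Q? i) ≤ 𝟙 (R? i)
      pointwise i with P? i | Q? i | R? i
      ... | yes p | yes q | _     = ⊥-elim (disjoint p q)
      ... | yes p | no _  | no ¬r = ⊥-elim (¬r (∪⊆R (inj₁ p)))
      ... | no _  | yes q | no ¬r = ⊥-elim (¬r (∪⊆R (inj₂ q)))
      ... | yes _ | no _  | yes _ = ≤-refl
      ... | no _  | yes _ | yes _ = ≤-refl
      ... | no _  | no _  | _     = z≤n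

    count-cover : (∀ {i} → R i → P i ⊎ Q i) → count R? ≤ count P? + count Q?
    count-cover R⊆∪ = begin
      count R?                       ≤⟨ ∑-mono-≤ pointwise ⟩
      ∑[ i < n ] (𝟙 (P? i) + 𝟙 (Q? i)) ≡⟨ ∑-distrib-+ (𝟙 ∘ P?) (𝟙 ∘ Q?) ⟩
      count P? + count Q?            ∎
      where
      open ≤-Reasoning
      pointwise : ∀ i → 𝟙 (R? i) ≤ 𝟙 (P? i) + 𝟙 (Q? i)
      pointwise i with R? i | P? i | Q? i
      ... | no _  | _     | _     = z≤n
      ... | yes _ | yes _ | _     = s≤s z≤n
      ... | yes _ | no _  | yes _ = s≤s z≤n
      ... | yes r | no ¬p | no ¬q with R⊆∪ r
      ...   | inj₁ p = ⊥-elim (¬p p)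
      ...   | inj₂ q = ⊥-elim (¬q q)

  count-mono : {P Q : Pred (Fin n) 0ℓ} (P? : Decidable P) (Q? : Decidable Q) → P ⊆ Q → count P? ≤ count Q?
  count-mono P? Q? P⊆Q = ∑-mono-≤ pointwise
    where
    pointwise : ∀ i → 𝟙 (P? i) ≤ 𝟙 (Q? i)
    pointwise i with P? i | Q? i
    ... | yes p | no ¬q = ⊥-elim (¬q (P⊆Q p))
    ... | yes _ | yes _ = ≤-refl
    ... | no _  | _     = z≤n

  count-cong : {P Q : Pred (Fin n) 0ℓ} (P? : Decidable P) (Q? : Decidable Q) → P ⊆ Q → Q ⊆ P → count P? ≡ count Q?
  count-cong P? Q? P⊆Q Q⊆P = ≤-antisym (count-mono P? Q? P⊆Q) (count-mono Q? P? Q⊆P)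

  1≤count : {P : Pred (Fin n) 0ℓ} (P? : Decidable P) {i : Fin n} → P i → 1 ≤ count P?
  1≤count P? {i} p = ≤-trans (1≤𝟙 (P? i) p) (≤-∑ (𝟙 ∘ P?) i)

  count-injection : ∀ {m} {P : Pred (Fin n) 0ℓ} (P? : Decidable P) (f : Fin m → Fin n) →
                    Injective _≡_ _≡_ f → (∀ j → P (f j)) → m ≤ count P?
  count-injection {zero}  P? f f-inj f∈P = z≤n
  count-injection {suc m} {P} P? f f-inj f∈P = begin
    suc m                                ≡⟨ +-comm 1 m ⟩
    m + 1                                ≤⟨ +-mono-≤ rest (1≤count (Fin._≟ f zero) refl) ⟩
    count P∖f₀? + count (Fin._≟ f zero)  ≤⟨ count-disjoint P∖f₀? (Fin._≟ f zero) P? proj₂ ∪⊆P ⟩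
    count P?                             ∎
    where
    open ≤-Reasoning
    P∖f₀ : Pred (Fin n) 0ℓ
    P∖f₀ i = P i × i ≢ f zero
    P∖f₀? : Decidable P∖f₀
    P∖f₀? i = P? i ×-dec ¬? (i Fin.≟ f zero)
    rest : m ≤ count P∖f₀?
    rest = count-injection P∖f₀? (f ∘ suc) (Finₚ.suc-injective ∘ f-inj)
             (λ j → f∈P (suc j) , λ f₁₊ⱼ≡f₀ → Finₚ.0≢1+n (sym (f-inj f₁₊ⱼ≡f₀)))
    ∪⊆P : ∀ {i} → P∖f₀ i ⊎ i ≡ f zero → P i
    ∪⊆P (inj₁ (p , _)) = p
    ∪⊆P (inj₂ refl)    = f∈P zero

count-< : ∀ {n} m → m ≤ n → count (λ (i : Fin n) → toℕ i <? m) ≡ m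
count-< {zero}  zero    _   = refl
count-< {suc n} zero    _   = ∑-zero {suc n} (λ _ → refl)
count-< {suc n} (suc m) m≤n = cong suc (count-< m (s≤s⁻¹ m≤n))

sum-allFin : ∀ {n} (f : Fin n → ℕ) → List.sum (map f (allFin n)) ≡ ∑[ i < n ] f i
sum-allFin f = trans (cong List.sum (Listₚ.map-tabulate id f)) (sum-tabulate f)
  where
  sum-tabulate : ∀ {n} (g : Fin n → ℕ) → List.sum (tabulate g) ≡ ∑[ i < n ] g i
  sum-tabulate {zero}  g = refl
  sum-tabulate {suc n} g = cong (g zero +_) (sum-tabulate (g ∘ suc))

module _ {n : ℕ} (G : Graph n) where

  edgeTerm : (Fin n → Fin n → ℕ) → Fin n → Fin n → ℕ
  edgeTerm f u v = if ⌊ u Finₚ.<? v ⌋ ∧ adj G u v then f u v else 0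

  edgeTerm-edge : ∀ {f u v} → u Fin.< v → adj G u v ≡ true → edgeTerm f u v ≡ f u v
  edgeTerm-edge {u = u} {v} u<v uv with u Finₚ.<? v
  ... | yes _   rewrite uv = refl
  ... | no u≮v = contradiction u<v u≮v

  edgeTerm-nonedge : ∀ {f u v} → adj G u v ≡ false → edgeTerm f u v ≡ 0
  edgeTerm-nonedge {u = u} {v} uv rewrite uv | ∧-zeroʳ ⌊ u Finₚ.<? v ⌋ = refl

  edgeTerm-≮ : ∀ {f u v} → ¬ u Fin.< v → edgeTerm f u v ≡ 0
  edgeTerm-≮ {u = u} {v} u≮v with u Finₚ.<? v
  ... | yes u<v = contradiction u<v u≮v
  ... | no _    = refl

  edgeSum-∑ : ∀ f → edgeSum G f ≡ ∑[ u < n ] ∑[ v < n ] edgeTerm f u v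
  edgeSum-∑ f = trans (sum-allFin (λ u → List.sum (map (edgeTerm f u) (allFin n))))
                      (sum-cong-≗ {n} (λ u → sum-allFin (edgeTerm f u)))

  edgeSum-mono : ∀ {f g} → (∀ {u v} → u Fin.< v → adj G u v ≡ true → f u v ≤ g u v) → edgeSum G f ≤ edgeSum G g
  edgeSum-mono {f} {g} f≤g = begin
    edgeSum G f                          ≡⟨ edgeSum-∑ f ⟩
    ∑[ u < n ] ∑[ v < n ] edgeTerm f u v ≤⟨ ∑-mono-≤ (λ u → ∑-mono-≤ (pointwise u)) ⟩
    ∑[ u < n ] ∑[ v < n ] edgeTerm g u v ≡⟨ edgeSum-∑ g ⟨
    edgeSum G g                          ∎
    where
    open ≤-Reasoning
    pointwise : ∀ u v → edgeTerm f u v ≤ edgeTerm g u v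
    pointwise u v with u Finₚ.<? v | adj G u v in uv
    ... | yes u<v | true  = f≤g u<v uv
    ... | yes _   | false = z≤n
    ... | no _    | _     = z≤n

  edgeSum-cong : ∀ {f g} → (∀ {u v} → u Fin.< v → adj G u v ≡ true → f u v ≡ g u v) → edgeSum G f ≡ edgeSum G g
  edgeSum-cong f≡g = ≤-antisym (edgeSum-mono (λ u<v uv → ≤-reflexive (f≡g u<v uv)))
                               (edgeSum-mono (λ u<v uv → ≤-reflexive (sym (f≡g u<v uv))))

  edgeSum-+ : ∀ f g → edgeSum G (λ u v → f u v + g u v) ≡ edgeSum G f + edgeSum G g
  edgeSum-+ f g = begin
    edgeSum G (λ u v → f u v + g u v)
      ≡⟨ edgeSum-∑ _ ⟩
    ∑[ u < n ] ∑[ v < n ] edgeTerm (λ u v → f u v + g u v) u v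
      ≡⟨ sum-cong-≗ {n} (λ u → trans (sum-cong-≗ {n} (pointwise u)) (∑-distrib-+ (edgeTerm f u) (edgeTerm g u))) ⟩
    ∑[ u < n ] (∑[ v < n ] edgeTerm f u v + ∑[ v < n ] edgeTerm g u v)
      ≡⟨ ∑-distrib-+ {n} _ _ ⟩
    ∑[ u < n ] ∑[ v < n ] edgeTerm f u v + ∑[ u < n ] ∑[ v < n ] edgeTerm g u v
      ≡⟨ cong₂ _+_ (edgeSum-∑ f) (edgeSum-∑ g) ⟨
    edgeSum G f + edgeSum G g
      ∎
    where
    open ≡-Reasoning
    pointwise : ∀ u v → edgeTerm (λ u v → f u v + g u v) u v ≡ edgeTerm f u v + edgeTerm g u v
    pointwise u v with ⌊ u Finₚ.<? v ⌋ ∧ adj G u v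
    ... | true  = refl
    ... | false = refl

  edgeSum-∑-comm : ∀ {m} (h : Fin n → Fin n → Fin m → ℕ) →
                   edgeSum G (λ u v → ∑[ p < m ] h u v p) ≡ ∑[ p < m ] edgeSum G (λ u v → h u v p)
  edgeSum-∑-comm {m} h = begin
    edgeSum G (λ u v → ∑[ p < m ] h u v p)
      ≡⟨ edgeSum-∑ _ ⟩
    ∑[ u < n ] ∑[ v < n ] edgeTerm (λ u v → ∑[ p < m ] h u v p) u v
      ≡⟨ sum-cong-≗ {n} (λ u → trans (sum-cong-≗ {n} (pointwise u)) (∑-comm {n} {m} _)) ⟩
    ∑[ u < n ] ∑[ p < m ] ∑[ v < n ] edgeTerm (λ u v → h u v p) u v
      ≡⟨ ∑-comm {n} {m} _ ⟩
    ∑[ p < m ] ∑[ u < n ] ∑[ v < n ] edgeTerm (λ u v → h u v p) u v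
      ≡⟨ sum-cong-≗ {m} (λ p → edgeSum-∑ _) ⟨
    ∑[ p < m ] edgeSum G (λ u v → h u v p)
      ∎
    where
    open ≡-Reasoning
    pointwise : ∀ u v → edgeTerm (λ u v → ∑[ p < m ] h u v p) u v ≡ ∑[ p < m ] edgeTerm (λ u v → h u v p) u v
    pointwise u v with ⌊ u Finₚ.<? v ⌋ ∧ adj G u v
    ... | true  = refl
    ... | false = sym (∑-zero {m} (λ _ → refl))

  term-≤-edgeSum : ∀ {f u v} → u Fin.< v → adj G u v ≡ true → f u v ≤ edgeSum G f
  term-≤-edgeSum {f} {u} {v} u<v uv = begin
    f u v                                ≡⟨ edgeTerm-edge {f} u<v uv ⟨
    edgeTerm f u v                       ≤⟨ ≤-∑ (edgeTerm f u) v ⟩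
    ∑[ w < n ] edgeTerm f u w            ≤⟨ ≤-∑ (λ u → ∑[ w < n ] edgeTerm f u w) u ⟩
    ∑[ u < n ] ∑[ w < n ] edgeTerm f u w ≡⟨ edgeSum-∑ f ⟨
    edgeSum G f                          ∎
    where open ≤-Reasoning

  edge-≤-edgeSum : ∀ {f k s t} → adj G s t ≡ true → k ≤ f s t → k ≤ f t s → k ≤ edgeSum G f
  edge-≤-edgeSum {s = s} {t} st k≤fst k≤fts with Finₚ.<-cmp s t
  ... | tri< s<t _ _  = ≤-trans k≤fst (term-≤-edgeSum s<t st)
  ... | tri≈ _ refl _ = contradiction (trans (sym st) (adj-irrefl G s)) λ ()
  ... | tri> _ _ t<s  = ≤-trans k≤fts (term-≤-edgeSum t<s (trans (adj-sym G t s) st))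

SameEdge : ∀ {n} → Fin n → Fin n → Fin n → Fin n → Set
SameEdge x y u v = (u ≡ x × v ≡ y) ⊎ (u ≡ y × v ≡ x)

module _ {n : ℕ} (G : Graph n) (x y : Fin n) where

  removeEdge-removes : ∀ {u v} → SameEdge x y u v → adj (removeEdge G x y) u v ≡ false
  removeEdge-removes (inj₁ (refl , refl)) with x Fin.≟ x | y Fin.≟ y
  ... | yes _ | yes _  = ∧-zeroʳ (adj G x y)
  ... | no x≢x | _     = contradiction refl x≢x
  ... | _      | no y≢y = contradiction refl y≢y
  removeEdge-removes (inj₂ (refl , refl)) with y Fin.≟ y | x Fin.≟ x
  ... | yes _ | yes _
    rewrite ∨-zeroʳ (⌊ y Fin.≟ x ⌋ ∧ ⌊ x Fin.≟ y ⌋) = ∧-zeroʳ (adj G y x)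
  ... | no y≢y | _      = contradiction refl y≢y
  ... | _      | no x≢x = contradiction refl x≢x

  removeEdge-keeps : ∀ {u v} → ¬ SameEdge x y u v → adj (removeEdge G x y) u v ≡ adj G u v
  removeEdge-keeps {u} {v} other with u Fin.≟ x | v Fin.≟ y | u Fin.≟ y | v Fin.≟ x
  ... | yes p | yes q | _     | _     = ⊥-elim (other (inj₁ (p , q)))
  ... | _     | _     | yes p | yes q = ⊥-elim (other (inj₂ (p , q)))
  ... | no _  | _     | no _  | _     = ∧-identityʳ _
  ... | no _  | _     | yes _ | no _  = ∧-identityʳ _
  ... | yes _ | no _  | no _  | _     = ∧-identityʳ _
  ... | yes _ | no _  | yes _ | no _  = ∧-identityʳ _

  private
    H : Graph n
    H = removeEdge G x y

    same-edge-orientations : ∀ {u v m M} → SameEdge x y u v → SameEdge x y m M →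
                             (u ≡ m × v ≡ M) ⊎ (u ≡ M × v ≡ m)
    same-edge-orientations (inj₁ (refl , refl)) (inj₁ (refl , refl)) = inj₁ (refl , refl)
    same-edge-orientations (inj₁ (refl , refl)) (inj₂ (refl , refl)) = inj₂ (refl , refl)
    same-edge-orientations (inj₂ (refl , refl)) (inj₁ (refl , refl)) = inj₂ (refl , refl)
    same-edge-orientations (inj₂ (refl , refl)) (inj₂ (refl , refl)) = inj₁ (refl , refl)

    edgeSum-removeEdge-at : ∀ {f m M} → m Fin.< M → adj G m M ≡ true → SameEdge x y m M →
                            edgeSum G f ≡ f m M + edgeSum H f
    edgeSum-removeEdge-at {f} {m} {M} m<M mM mM-is-xy = begin
      edgeSum G f
        ≡⟨ edgeSum-∑ G f ⟩
      ∑[ u < n ] ∑[ v < n ] edgeTerm G f u v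
        ≡⟨ sum-cong-≗ {n} (λ u → trans (sum-cong-≗ {n} (pointwise u)) (∑-distrib-+ (δ u) _)) ⟩
      ∑[ u < n ] (∑[ v < n ] δ u v + ∑[ v < n ] edgeTerm H f u v)
        ≡⟨ ∑-distrib-+ {n} _ _ ⟩
      ∑[ u < n ] ∑[ v < n ] δ u v + ∑[ u < n ] ∑[ v < n ] edgeTerm H f u v
        ≡⟨ cong₂ _+_ ∑∑δ (sym (edgeSum-∑ H f)) ⟩
      f m M + edgeSum H f
        ∎
      where
      open ≡-Reasoning
      δ : Fin n → Fin n → ℕ
      δ u v = if does (u Fin.≟ m) then (if does (v Fin.≟ M) then f m M else 0) else 0

      ∑∑δ : ∑[ u < n ] ∑[ v < n ] δ u v ≡ f m M
      ∑∑δ = trans (sum-cong-≗ {n} row) (∑-indicator m (f m M))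
        where
        row : ∀ u → ∑[ v < n ] δ u v ≡ (if does (u Fin.≟ m) then f m M else 0)
        row u with does (u Fin.≟ m)
        ... | true  = ∑-indicator M (f m M)
        ... | false = ∑-zero {n} (λ _ → refl)

      unchanged : ∀ {u v} → ¬ (u ≡ m × v ≡ M) → edgeTerm G f u v ≡ edgeTerm H f u v
      unchanged {u} {v} not-mM with ((u Fin.≟ x) ×-dec (v Fin.≟ y)) ⊎-dec ((u Fin.≟ y) ×-dec (v Fin.≟ x))
      ... | no other = cong (λ b → if ⌊ u Finₚ.<? v ⌋ ∧ b then f u v else 0) (sym (removeEdge-keeps other))
      ... | yes uv-is-xy with same-edge-orientations uv-is-xy mM-is-xy
      ...   | inj₁ uv≡mM      = contradiction uv≡mM not-mM
      ...   | inj₂ (refl , refl) = trans (edgeTerm-≮ G {f} M≮m) (sym (edgeTerm-≮ H {f} M≮m))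
        where
        M≮m : ¬ M Fin.< m
        M≮m = Finₚ.<-asym m<M

      pointwise : ∀ u v → edgeTerm G f u v ≡ δ u v + edgeTerm H f u v
      pointwise u v with u Fin.≟ m | v Fin.≟ M
      ... | yes refl | yes refl = begin
        edgeTerm G f m M         ≡⟨ edgeTerm-edge G {f} m<M mM ⟩
        f m M                    ≡⟨ +-identityʳ (f m M) ⟨
        f m M + 0                ≡⟨ cong (f m M +_) (edgeTerm-nonedge H {f} (removeEdge-removes mM-is-xy)) ⟨
        f m M + edgeTerm H f m M ∎
      ... | yes _    | no v≢M  = unchanged (v≢M ∘ proj₂)
      ... | no u≢m   | _       = unchanged (u≢m ∘ proj₁)

  edgeSum-removeEdge : ∀ {f} → f y x ≡ f x y → adj G x y ≡ true →
                       edgeSum G f ≡ f x y + edgeSum (removeEdge G x y) f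
  edgeSum-removeEdge {f} fyx≡fxy xy with Finₚ.<-cmp x y
  ... | tri< x<y _ _  = edgeSum-removeEdge-at x<y xy (inj₁ (refl , refl))
  ... | tri≈ _ refl _ = contradiction (trans (sym xy) (adj-irrefl G x)) λ ()
  ... | tri> _ _ y<x  = trans (edgeSum-removeEdge-at y<x (trans (adj-sym G y x) xy) (inj₂ (refl , refl)))
                              (cong (_+ edgeSum H f) fyx≡fxy)

module _ {n : ℕ} {G : Graph n} where

  Reach-snoc : ∀ {u v w} → Reach G u v → adj G v w ≡ true → Reach G u w
  Reach-snoc here        vw = step vw here
  Reach-snoc (step ut r) vw = step ut (Reach-snoc r vw)

  Reach-trans : ∀ {u v w} → Reach G u v → Reach G v w → Reach G u w
  Reach-trans here        r = r
  Reach-trans (step ut r) s = step ut (Reach-trans r s)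

  Reach-sym : ∀ {u v} → Reach G u v → Reach G v u
  Reach-sym here                = here
  Reach-sym (step {u} {t} ut r) = Reach-snoc (Reach-sym r) (trans (adj-sym G t u) ut)

injective⇒surjective : ∀ {n} {f : Fin n → Fin n} → Injective _≡_ _≡_ f → StrictlySurjective _≡_ f
injective⇒surjective {suc n} {f} f-inj y with Finₚ.any? (λ x → f x Fin.≟ y)
... | yes hit = hit
... | no miss = contradiction (Finₚ.injective⇒≤ f-avoiding-y-inj) (<-irrefl refl)
  where
  f-avoiding-y : Fin (suc n) → Fin n
  f-avoiding-y x = punchOut {i = y} (λ y≡fx → miss (x , sym y≡fx))
  f-avoiding-y-inj : Injective _≡_ _≡_ f-avoiding-y
  f-avoiding-y-inj {a} {b} =
    f-inj ∘ Finₚ.punchOut-injective {i = y} (λ y≡fa → miss (a , sym y≡fa)) (λ y≡fb → miss (b , sym y≡fb))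

fromInjection : ∀ {n} (f : Fin n → Fin n) → Injective _≡_ _≡_ f → Arrangement n
fromInjection f f-inj = mk⤖ (f-inj , λ y → let (x , fx≡y) = injective⇒surjective f-inj y in x , λ { refl → fx≡y })

module Positions {n : ℕ} (α : Arrangement n) where

  vertexAt : Fin n → Fin n
  vertexAt = Bijection.to⁻ α

  pos-vertexAt : ∀ p → pos α (vertexAt p) ≡ toℕ p
  pos-vertexAt p = cong toℕ (Surjection.to∘to⁻ (Bijection.surjection α) p)

  pos-injective : ∀ {u v} → pos α u ≡ pos α v → u ≡ v
  pos-injective = Bijection.injective α ∘ Finₚ.toℕ-injective

  vertexAt-pos : ∀ {p v} → toℕ p ≡ pos α v → vertexAt p ≡ v
  vertexAt-pos {p} p≡v = pos-injective (trans (pos-vertexAt p) p≡v)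

  pos<n : ∀ v → pos α v < n
  pos<n v = Finₚ.toℕ<n (Bijection.to α v)

  0<∣pos-pos∣ : ∀ {u v} → u ≢ v → 0 < ∣ pos α u - pos α v ∣
  0<∣pos-pos∣ u≢v = n≢0⇒n>0 (u≢v ∘ pos-injective ∘ ∣m-n∣≡0⇒m≡n)

  Leftmost Rightmost : Fin n → Set
  Leftmost  l = ∀ v → pos α l ≤ pos α v
  Rightmost r = ∀ v → pos α v ≤ pos α r

  leftmost : Fin n → ∃ Leftmost
  leftmost v₀ = vertexAt first , λ v →
    subst (_≤ pos α v) (sym (trans (pos-vertexAt first) (Finₚ.toℕ-fromℕ< 0<n))) z≤n
    where
    0<n : 0 < n
    0<n = ≤-<-trans z≤n (pos<n v₀)
    first : Fin n
    first = fromℕ< 0<n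

  rightmost : Fin n → ∃ Rightmost
  rightmost v₀ = vertexAt last , λ v →
    subst (pos α v ≤_) (sym (trans (pos-vertexAt last) (Finₚ.toℕ-fromℕ< n∸1<n))) (<⇒≤pred (pos<n v))
    where
    n∸1<n : n ∸ 1 < n
    n∸1<n = ∸-monoʳ-< z<s (≤-<-trans z≤n (pos<n v₀))
    last : Fin n
    last = fromℕ< n∸1<n

  later : ∀ {P : Fin n → Set} {u v} → P u → P v → ∃ λ w → P w × pos α u ≤ pos α w × pos α v ≤ pos α w
  later {u = u} {v} pu pv with ≤-total (pos α u) (pos α v)
  ... | inj₁ u≤v = v , pv , u≤v , ≤-refl
  ... | inj₂ v≤u = u , pu , ≤-refl , v≤u

  earlier : ∀ {P : Fin n → Set} {u v} → P u → P v → ∃ λ w → P w × pos α w ≤ pos α u × pos α w ≤ pos α v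
  earlier {u = u} {v} pu pv with ≤-total (pos α u) (pos α v)
  ... | inj₁ u≤v = u , pu , ≤-refl , u≤v
  ... | inj₂ v≤u = v , pv , v≤u , ≤-refl

module _ {n : ℕ} (G : Graph n) where

  cost≡netCost+edges : ∀ γ → cost γ G ≡ netCost γ G + edgeSum G (λ _ _ → 1)
  cost≡netCost+edges γ = trans (edgeSum-cong G (λ u<v _ → sym (m∸n+n≡m (0<∣pos-pos∣ (Finₚ.<⇒≢ u<v))))) (edgeSum-+ G _ _)
    where open Positions γ

  optimal⇒isOlaPlus : ∀ {α} → Optimal G α → IsOlaPlus G (netCost α G)
  optimal⇒isOlaPlus {α} opt = (α , refl) , λ β → +-cancelʳ-≤ _ _ _
    (subst₂ _≤_ (cost≡netCost+edges α) (cost≡netCost+edges β) (opt β))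

m≤n⇒∣m-n∣+m≡n : ∀ {m n} → m ≤ n → ∣ m - n ∣ + m ≡ n
m≤n⇒∣m-n∣+m≡n {m} m≤n = trans (cong (_+ m) (m≤n⇒∣m-n∣≡n∸m m≤n)) (m∸n+n≡m m≤n)

Between : ℕ → ℕ → ℕ → Set
Between a p b = (a < p × p < b) ⊎ (b < p × p < a)

between-ordered : ∀ {a p b} → a < b → Between a p b → a < p × p < b
between-ordered a<b (inj₁ a<p<b)       = a<p<b
between-ordered a<b (inj₂ (b<p , p<a)) = contradiction (<-trans a<b b<p) (<-asym p<a)

module Colouring {n : ℕ} (α : Arrangement n) (c : Fin n → Bool) where

  open Positions α

  colourAt : Fin n → Bool
  colourAt p = c (vertexAt p)

  colourAt-pos : ∀ {p v} → toℕ p ≡ pos α v → colourAt p ≡ c v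
  colourAt-pos = cong c ∘ vertexAt-pos

  Before : Bool → ℕ → Pred (Fin n) 0ℓ
  Before b m p = toℕ p < m × colourAt p ≡ b

  before? : ∀ b m → Decidable (Before b m)
  before? b m p = (toℕ p <? m) ×-dec (colourAt p Bool.≟ b)

  countBefore : Bool → ℕ → ℕ
  countBefore b m = count (before? b m)

  countBefore-mono : ∀ b {a m} → a ≤ m → countBefore b a ≤ countBefore b m
  countBefore-mono b a≤m = count-mono (before? b _) (before? b _) (λ (p<a , pb) → <-≤-trans p<a a≤m , pb)

  countBefore-< : ∀ {b v m} → c v ≡ b → pos α v < m → countBefore b (pos α v) < countBefore b m
  countBefore-< {b} {v} {m} cv≡b v<m = begin
    suc (countBefore b (pos α v))            ≡⟨ +-comm 1 _ ⟩
    countBefore b (pos α v) + 1              ≤⟨ +-monoʳ-≤ _ (1≤count at-v? {Bijection.to α v} refl) ⟩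
    countBefore b (pos α v) + count at-v?    ≤⟨ count-disjoint (before? b _) at-v? (before? b m) disjoint ∪⊆ ⟩
    countBefore b m                          ∎
    where
    open ≤-Reasoning
    at-v? : Decidable (λ p → toℕ p ≡ pos α v)
    at-v? p = toℕ p ≟ pos α v
    disjoint : ∀ {p} → Before b (pos α v) p → toℕ p ≡ pos α v → ⊥
    disjoint (p<v , _) p≡v = <-irrefl p≡v p<v
    ∪⊆ : ∀ {p} → Before b (pos α v) p ⊎ toℕ p ≡ pos α v → Before b m p
    ∪⊆ (inj₁ (p<v , pb)) = <-trans p<v v<m , pb
    ∪⊆ (inj₂ p≡v)        = subst (_< m) (sym p≡v) v<m , trans (colourAt-pos p≡v) cv≡b

  countBefore-total : ∀ b {m} → m ≤ n → countBefore b m + countBefore (not b) m ≡ m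
  countBefore-total b {m} m≤n = ≤-antisym
    (≤-trans (count-disjoint (before? b m) (before? (not b) m) (λ p → toℕ p <? m) disjoint ∪⊆) (≤-reflexive (count-< m m≤n)))
    (≤-trans (≤-reflexive (sym (count-< m m≤n))) (count-cover (before? b m) (before? (not b) m) (λ p → toℕ p <? m) cover))
    where
    disjoint : ∀ {p} → Before b m p → Before (not b) m p → ⊥
    disjoint (_ , pb) (_ , p¬b) = not-¬ pb p¬b
    ∪⊆ : ∀ {p} → Before b m p ⊎ Before (not b) m p → toℕ p < m
    ∪⊆ (inj₁ (p<m , _)) = p<m
    ∪⊆ (inj₂ (p<m , _)) = p<m
    cover : ∀ {p} → toℕ p < m → Before b m p ⊎ Before (not b) m p
    cover {p} p<m with colourAt p Bool.≟ b
    ... | yes pb  = inj₁ (p<m , pb)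
    ... | no p≢b  = inj₂ (p<m , ¬-not p≢b)

  countBefore-injective : ∀ {u v} → c u ≡ c v → countBefore (c u) (pos α u) ≡ countBefore (c u) (pos α v) → u ≡ v
  countBefore-injective {u} {v} cu≡cv same-count with <-cmp (pos α u) (pos α v)
  ... | tri< u<v _ _ = contradiction same-count (<⇒≢ (countBefore-< refl u<v))
  ... | tri≈ _ u≡v _ = pos-injective u≡v
  ... | tri> _ _ v<u = contradiction (sym same-count) (<⇒≢ (countBefore-< (sym cu≡cv) v<u))

  Jumps : Fin n → Fin n → Pred (Fin n) 0ℓ
  Jumps u v p = Between (pos α u) (toℕ p) (pos α v) × colourAt p ≡ not (c u)

  jumps? : ∀ u v → Decidable (Jumps u v)
  jumps? u v p = (((pos α u <? toℕ p) ×-dec (toℕ p <? pos α v)) ⊎-dec ((pos α v <? toℕ p) ×-dec (toℕ p <? pos α u)))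
                 ×-dec (colourAt p Bool.≟ not (c u))

  jumps : Fin n → Fin n → ℕ
  jumps u v = count (jumps? u v)

  Jumps-reverse : ∀ {u v} → c u ≡ c v → Jumps u v ⊆ Jumps v u
  Jumps-reverse cu≡cv (between , p-colour) = swap between , trans p-colour (cong not cu≡cv)

  jumps-sym : ∀ {u v} → c u ≡ c v → jumps u v ≡ jumps v u
  jumps-sym cu≡cv = count-cong (jumps? _ _) (jumps? _ _) (Jumps-reverse cu≡cv) (Jumps-reverse (sym cu≡cv))


  jumps-≤ : ∀ {u v} → pos α u < pos α v →
            jumps u v + countBefore (not (c u)) (pos α u) ≤ countBefore (not (c u)) (pos α v)
  jumps-≤ {u} {v} u<v = count-disjoint (jumps? u v) (before? _ _) (before? _ _) disjoint ∪⊆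
    where
    disjoint : ∀ {p} → Jumps u v p → Before (not (c u)) (pos α u) p → ⊥
    disjoint (between , _) (p<u , _) = <-asym p<u (proj₁ (between-ordered u<v between))
    ∪⊆ : ∀ {p} → Jumps u v p ⊎ Before (not (c u)) (pos α u) p → Before (not (c u)) (pos α v) p
    ∪⊆ (inj₁ (between , p-colour)) = proj₂ (between-ordered u<v between) , p-colour
    ∪⊆ (inj₂ (p<u , p-colour))     = <-trans p<u u<v , p-colour

  -- The vertices of colour b first, then the others, each group in α-order.
  module Grouped (b : Bool) where

    offset : Bool → ℕ
    offset d = if ⌊ d Bool.≟ b ⌋ then 0 else countBefore b n

    rank : Fin n → ℕ
    rank v = offset (c v) + countBefore (c v) (pos α v)

    rank-first : ∀ {v} → c v ≡ b → rank v ≡ countBefore b (pos α v)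
    rank-first {v} refl with c v Bool.≟ c v
    ... | yes _    = refl
    ... | no cv≢cv = contradiction refl cv≢cv

    rank-second : ∀ {v} → c v ≡ not b → rank v ≡ countBefore b n + countBefore (not b) (pos α v)
    rank-second {v} cv≡¬b with c v Bool.≟ b
    ... | yes cv≡b = contradiction cv≡b (subst (_≢ b) (sym cv≡¬b) (not-¬ refl ∘ sym))
    ... | no _     = cong (λ d → countBefore b n + countBefore d (pos α v)) cv≡¬b

    countBefore-all : countBefore b n + countBefore (not b) n ≡ n
    countBefore-all = countBefore-total b ≤-refl

    first<second : ∀ {u v} → c u ≡ b → c v ≡ not b → rank u < rank v
    first<second {u} {v} cu≡b cv≡¬b = begin-strict
      rank u                                          ≡⟨ rank-first cu≡b ⟩
      countBefore b (pos α u)                         <⟨ countBefore-< cu≡b (pos<n u) ⟩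
      countBefore b n                                 ≤⟨ m≤m+n _ _ ⟩
      countBefore b n + countBefore (not b) (pos α v) ≡⟨ rank-second cv≡¬b ⟨
      rank v                                          ∎
      where open ≤-Reasoning

    rank<n : ∀ v → rank v < n
    rank<n v = by-colour (c v Bool.≟ b)
      where
      open ≤-Reasoning
      by-colour : Dec (c v ≡ b) → rank v < n
      by-colour (yes cv≡b) = begin-strict
        rank v                                  ≡⟨ rank-first cv≡b ⟩
        countBefore b (pos α v)                 <⟨ countBefore-< cv≡b (pos<n v) ⟩
        countBefore b n                         ≤⟨ m≤m+n _ _ ⟩
        countBefore b n + countBefore (not b) n ≡⟨ countBefore-all ⟩
        n                                       ∎
      by-colour (no cv≢b) = begin-strict
        rank v                                          ≡⟨ rank-second (¬-not cv≢b) ⟩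
        countBefore b n + countBefore (not b) (pos α v) <⟨ +-monoʳ-< _ (countBefore-< (¬-not cv≢b) (pos<n v)) ⟩
        countBefore b n + countBefore (not b) n         ≡⟨ countBefore-all ⟩
        n                                               ∎

    same-colour-rank : ∀ {u v} → c u ≡ c v →
                       ∣ rank u - rank v ∣ ≡ ∣ countBefore (c u) (pos α u) - countBefore (c u) (pos α v) ∣
    same-colour-rank {u} {v} cu≡cv rewrite cu≡cv = ∣m+n-m+o∣≡∣n-o∣ (offset (c v)) _ _

    rank-injective : ∀ {u v} → rank u ≡ rank v → u ≡ v
    rank-injective {u} {v} ru≡rv = by-colours (c u Bool.≟ b) (c v Bool.≟ b)
      where
      same-colour : c u ≡ c v → u ≡ v
      same-colour cu≡cv = countBefore-injective cu≡cv
        (∣m-n∣≡0⇒m≡n (trans (sym (same-colour-rank cu≡cv)) (m≡n⇒∣m-n∣≡0 ru≡rv)))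
      by-colours : Dec (c u ≡ b) → Dec (c v ≡ b) → u ≡ v
      by-colours (yes cu≡b) (yes cv≡b) = same-colour (trans cu≡b (sym cv≡b))
      by-colours (no cu≢b)  (no cv≢b)  = same-colour (trans (¬-not cu≢b) (sym (¬-not cv≢b)))
      by-colours (yes cu≡b) (no cv≢b)  = contradiction ru≡rv (<⇒≢ (first<second cu≡b (¬-not cv≢b)))
      by-colours (no cu≢b)  (yes cv≡b) = contradiction (sym ru≡rv) (<⇒≢ (first<second cv≡b (¬-not cu≢b)))

    grouped : Arrangement n
    grouped = fromInjection (λ v → fromℕ< (rank<n v)) (λ {u} {v} eq → rank-injective (begin
      rank u                    ≡⟨ Finₚ.toℕ-fromℕ< (rank<n u) ⟨
      toℕ (fromℕ< (rank<n u))   ≡⟨ cong toℕ eq ⟩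
      toℕ (fromℕ< (rank<n v))   ≡⟨ Finₚ.toℕ-fromℕ< (rank<n v) ⟩
      rank v                    ∎))
      where open ≡-Reasoning

    pos-grouped : ∀ v → pos grouped v ≡ rank v
    pos-grouped v = Finₚ.toℕ-fromℕ< (rank<n v)

    rank-gap : ∀ {u v} → c u ≡ c v → pos α u ≤ pos α v →
               ∣ rank u - rank v ∣ + countBefore (c u) (pos α u) ≡ countBefore (c u) (pos α v)
    rank-gap cu≡cv u≤v = trans (cong (_+ _) (same-colour-rank cu≡cv)) (m≤n⇒∣m-n∣+m≡n (countBefore-mono _ u≤v))

    grouped-shortens : ∀ {u v} → c u ≡ c v → u ≢ v → ∣ rank u - rank v ∣ + jumps u v ≤ ∣ pos α u - pos α v ∣
    grouped-shortens {u} {v} cu≡cv u≢v = by-order (<-cmp (pos α u) (pos α v))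
      where
      ordered : ∀ {u v} → c u ≡ c v → pos α u < pos α v → ∣ rank u - rank v ∣ + jumps u v ≤ ∣ pos α u - pos α v ∣
      ordered {u} {v} cu≡cv u<v = +-cancelʳ-≤ (pos α u) _ _ (begin
        ∣ rank u - rank v ∣ + jumps u v + pos α u
          ≡⟨ cong (∣ rank u - rank v ∣ + jumps u v +_) (sym (countBefore-total (c u) (<⇒≤ (pos<n u)))) ⟩
        ∣ rank u - rank v ∣ + jumps u v + (countBefore (c u) (pos α u) + countBefore (not (c u)) (pos α u))
          ≡⟨ +-interchange ∣ rank u - rank v ∣ (jumps u v) _ _ ⟩
        (∣ rank u - rank v ∣ + countBefore (c u) (pos α u)) + (jumps u v + countBefore (not (c u)) (pos α u))
          ≤⟨ +-mono-≤ (≤-reflexive (rank-gap cu≡cv (<⇒≤ u<v))) (jumps-≤ u<v) ⟩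
        countBefore (c u) (pos α v) + countBefore (not (c u)) (pos α v)
          ≡⟨ countBefore-total (c u) (<⇒≤ (pos<n v)) ⟩
        pos α v
          ≡⟨ m≤n⇒∣m-n∣+m≡n (<⇒≤ u<v) ⟨
        ∣ pos α u - pos α v ∣ + pos α u ∎)
        where open ≤-Reasoning
      by-order : Tri (pos α u < pos α v) (pos α u ≡ pos α v) (pos α v < pos α u) →
                 ∣ rank u - rank v ∣ + jumps u v ≤ ∣ pos α u - pos α v ∣
      by-order (tri< u<v _ _) = ordered cu≡cv u<v
      by-order (tri≈ _ u≡v _) = contradiction (pos-injective u≡v) u≢v
      by-order (tri> _ _ v<u) = subst₂ _≤_ (cong₂ _+_ (∣-∣-comm (rank v) (rank u)) (jumps-sym (sym cu≡cv)))
                                          (∣-∣-comm (pos α v) (pos α u)) (ordered (sym cu≡cv) v<u)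

    grouped-stretch : ∀ {u v} → c u ≡ b → c v ≡ not b →
                      ∣ rank u - rank v ∣ + countBefore b (pos α u) ≡ countBefore b n + countBefore (not b) (pos α v)
    grouped-stretch {u} {v} cu≡b cv≡¬b = begin
      ∣ rank u - rank v ∣ + countBefore b (pos α u) ≡⟨ cong (∣ rank u - rank v ∣ +_) (rank-first cu≡b) ⟨
      ∣ rank u - rank v ∣ + rank u                  ≡⟨ m≤n⇒∣m-n∣+m≡n (<⇒≤ (first<second cu≡b cv≡¬b)) ⟩
      rank v                                        ≡⟨ rank-second cv≡¬b ⟩
      countBefore b n + countBefore (not b) (pos α v) ∎
      where open ≡-Reasoning

  -- Regrouping shortens uv by jumps u v and leaves it of length at least 1.
  jumps<∣pos-pos∣ : ∀ {u v} → c u ≡ c v → u ≢ v → jumps u v < ∣ pos α u - pos α v ∣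
  jumps<∣pos-pos∣ {u} {v} cu≡cv u≢v =
    <-≤-trans (m<n+m (jumps u v) (n≢0⇒n>0 (u≢v ∘ rank-injective ∘ ∣m-n∣≡0⇒m≡n))) (grouped-shortens cu≡cv u≢v)
    where open Grouped (c u)

  leftmost-≤ : ∀ {l} → Leftmost l → ∀ p → pos α l ≤ toℕ p
  leftmost-≤ {l} l-left p = subst (pos α l ≤_) (pos-vertexAt p) (l-left (vertexAt p))

  ≤-rightmost : ∀ {r} → Rightmost r → ∀ p → toℕ p ≤ pos α r
  ≤-rightmost {r} r-right p = subst (_≤ pos α r) (pos-vertexAt p) (r-right (vertexAt p))

  -- When x is left of y the pair e < a makes the inequality strict, otherwise ∣ x - y ∣ ≥ 1 does.
  stretch-bound : ∀ {b x y a e} → c a ≡ b → c y ≡ not b → pos α e < pos α a → pos α e ≤ pos α y → pos α x ≤ pos α a →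
                  countBefore (not b) (pos α y) + countBefore b (pos α e)
                    < countBefore (not b) (pos α a) + ∣ pos α x - pos α y ∣ + countBefore b (pos α x)
  stretch-bound {b} {x} {y} {a} {e} ca≡b cy≡¬b e<a e≤y x≤a = by-order (≤-<-connex (pos α x) (pos α y))
    where
    A B : ℕ → ℕ
    A = countBefore b
    B = countBefore (not b)
    d : ℕ
    d = ∣ pos α x - pos α y ∣
    open ≤-Reasoning
    by-order : pos α x ≤ pos α y ⊎ pos α y < pos α x → B (pos α y) + A (pos α e) < B (pos α a) + d + A (pos α x)
    by-order (inj₁ x≤y) = +-cancelʳ-< (B (pos α x)) _ _ (begin-strict
      B (pos α y) + A (pos α e) + B (pos α x)   ≡⟨ +-assoc (B (pos α y)) _ _ ⟩
      B (pos α y) + (A (pos α e) + B (pos α x)) <⟨ +-monoʳ-< (B (pos α y)) (Ae+Bx<Ay+Ba (<-cmp (pos α a) (pos α y))) ⟩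
      B (pos α y) + (A (pos α y) + B (pos α a)) ≡⟨ x∙yz≈z∙yx (B (pos α y)) (A (pos α y)) (B (pos α a)) ⟩
      B (pos α a) + (A (pos α y) + B (pos α y)) ≡⟨ cong (B (pos α a) +_) (countBefore-total b (<⇒≤ (pos<n y))) ⟩
      B (pos α a) + pos α y                     ≡⟨ cong (B (pos α a) +_) (m≤n⇒∣m-n∣+m≡n x≤y) ⟨
      B (pos α a) + (d + pos α x)               ≡⟨ cong (λ m → B (pos α a) + (d + m)) (countBefore-total b (<⇒≤ (pos<n x))) ⟨
      B (pos α a) + (d + (A (pos α x) + B (pos α x))) ≡⟨ trans (+-assoc (B (pos α a) + d) _ _) (+-assoc (B (pos α a)) d _) ⟨
      B (pos α a) + d + A (pos α x) + B (pos α x) ∎)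
      where
      Ae+Bx<Ay+Ba : Tri (pos α a < pos α y) (pos α a ≡ pos α y) (pos α y < pos α a) →
                        A (pos α e) + B (pos α x) < A (pos α y) + B (pos α a)
      Ae+Bx<Ay+Ba (tri< a<y _ _) = +-mono-<-≤ (≤-<-trans (countBefore-mono b (<⇒≤ e<a)) (countBefore-< ca≡b a<y))
                                                  (countBefore-mono (not b) x≤a)
      Ae+Bx<Ay+Ba (tri≈ _ a≡y _) = contradiction (trans (sym ca≡b) (trans (cong c (pos-injective a≡y)) cy≡¬b)) (not-¬ refl)
      Ae+Bx<Ay+Ba (tri> _ _ y<a) = +-mono-≤-< (countBefore-mono b e≤y)
                                                  (≤-<-trans (countBefore-mono (not b) x≤y) (countBefore-< cy≡¬b y<a))
    by-order (inj₂ y<x) = begin-strict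
      B (pos α y) + A (pos α e)
        ≤⟨ +-mono-≤ (countBefore-mono (not b) (<⇒≤ (<-≤-trans y<x x≤a))) (countBefore-mono b (<⇒≤ (≤-<-trans e≤y y<x))) ⟩
      B (pos α a) + A (pos α x)
        <⟨ +-monoˡ-< (A (pos α x)) (m<m+n (B (pos α a)) (n≢0⇒n>0 (<⇒≢ y<x ∘ sym ∘ ∣m-n∣≡0⇒m≡n))) ⟩
      B (pos α a) + d + A (pos α x)
        ∎

  countColour : Bool → ℕ
  countColour b = count (λ p → colourAt p Bool.≟ b)

  moreThan-<-countColour : ∀ {k b} → MoreThan k (λ v → c v ≡ b) → k < countColour b
  moreThan-<-countColour (f , f-inj , f-b) =
    count-injection (λ p → colourAt p Bool.≟ _) (Bijection.to α ∘ f) (f-inj ∘ Bijection.injective α)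
      (λ i → trans (colourAt-pos refl) (f-b i))

  module Walks (H : Graph n) (monochromatic : ∀ {u v} → adj H u v ≡ true → c u ≡ c v) where

    Reach-monochromatic : ∀ {u w} → Reach H u w → c u ≡ c w
    Reach-monochromatic here        = refl
    Reach-monochromatic (step ut r) = trans (monochromatic ut) (Reach-monochromatic r)

    JumpedIn : Fin n → Set
    JumpedIn p = ∃ λ s → ∃ λ t → adj H s t ≡ true × Jumps s t p

    walk-jumps : ∀ {u w p} → Reach H u w → pos α u < toℕ p → toℕ p < pos α w → colourAt p ≡ not (c u) → JumpedIn p
    walk-jumps here u<p p<u _ = contradiction u<p (<-asym p<u)
    walk-jumps {u} {p = p} (step {w = t} ut r) u<p p<w p-colour with <-cmp (pos α t) (toℕ p)
    ... | tri< t<p _ _ = walk-jumps r t<p p<w (trans p-colour (cong not (monochromatic ut)))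
    ... | tri≈ _ t≡p _ = contradiction (trans (sym (trans (colourAt-pos (sym t≡p)) (sym (monochromatic ut)))) p-colour) (not-¬ refl)
    ... | tri> _ _ p<t = u , t , ut , inj₁ (u<p , p<t) , p-colour

    jumped-between : ∀ {u w p} → Reach H u w → pos α u ≤ toℕ p → toℕ p ≤ pos α w → colourAt p ≡ not (c u) → JumpedIn p
    jumped-between {u} {w} {p} r u≤p p≤w p-colour = walk-jumps r
      (≤∧≢⇒< u≤p (λ u≡p → not-¬ refl (trans (sym (colourAt-pos (sym u≡p))) p-colour)))
      (≤∧≢⇒< p≤w (λ p≡w → not-¬ refl (trans (sym (trans (colourAt-pos p≡w) (sym (Reach-monochromatic r)))) p-colour)))
      p-colour

    jumpSum : ℕ
    jumpSum = edgeSum H jumps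

    count-≤-jumpSum : ∀ {Q : Pred (Fin n) 0ℓ} (Q? : Decidable Q) → (∀ {p} → Q p → JumpedIn p) → count Q? ≤ jumpSum
    count-≤-jumpSum Q? jumped = begin
      count Q?                                           ≤⟨ ∑-mono-≤ pointwise ⟩
      ∑[ p < n ] edgeSum H (λ s t → 𝟙 (jumps? s t p))     ≡⟨ edgeSum-∑-comm H (λ s t p → 𝟙 (jumps? s t p)) ⟨
      jumpSum                                            ∎
      where
      open ≤-Reasoning
      pointwise : ∀ p → 𝟙 (Q? p) ≤ edgeSum H (λ s t → 𝟙 (jumps? s t p))
      pointwise p with Q? p
      ... | no _  = z≤n
      ... | yes q = let (s , t , st , s-t-jumps) = jumped q in
        edge-≤-edgeSum H st (1≤𝟙 (jumps? s t p) s-t-jumps) (1≤𝟙 (jumps? t s p) (Jumps-reverse (monochromatic st) s-t-jumps))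

    jumpSum-≤-netCost : jumpSum ≤ netCost α H
    jumpSum-≤-netCost = edgeSum-mono H (λ u<v uv → <⇒≤pred (jumps<∣pos-pos∣ (monochromatic uv) (Finₚ.<⇒≢ u<v)))

    countColour-≤-jumpSum : ∀ {l r} → Leftmost l → Rightmost r → Reach H l r → countColour (not (c l)) ≤ jumpSum
    countColour-≤-jumpSum {l} {r} l-left r-right lr = count-≤-jumpSum (λ p → colourAt p Bool.≟ not (c l))
      (λ {p} p-colour → jumped-between lr (leftmost-≤ l-left p) (≤-rightmost r-right p) p-colour)

    -- The walk l → a jumps every position of colour not b before a, the walk e → r every position
    -- of colour b from e on.
    jumpSum-lower-bound : ∀ {b l a e r} → Leftmost l → Rightmost r → c l ≡ b → c e ≡ not b → Reach H l a → Reach H e r →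
                          countBefore (not b) (pos α a) + countBefore b n ≤ jumpSum + countBefore b (pos α e)
    jumpSum-lower-bound {b} {l} {a} {e} {r} l-left r-right cl≡b ce≡¬b la er = begin
      B-a + countBefore b n                           ≤⟨ +-monoʳ-≤ B-a split-at-e ⟩
      B-a + (countBefore b (pos α e) + count from-e?) ≡⟨ x∙yz≈xz∙y B-a (countBefore b (pos α e)) (count from-e?) ⟩
      B-a + count from-e? + countBefore b (pos α e)   ≤⟨ +-monoˡ-≤ (countBefore b (pos α e)) all-jumped ⟩
      jumpSum + countBefore b (pos α e)               ∎
      where
      open ≤-Reasoning
      B-a : ℕ
      B-a = countBefore (not b) (pos α a)
      From-e : Pred (Fin n) 0ℓ
      From-e p = pos α e ≤ toℕ p × colourAt p ≡ b
      from-e? : Decidable From-e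
      from-e? p = (pos α e ≤? toℕ p) ×-dec (colourAt p Bool.≟ b)
      either? : Decidable (λ p → Before (not b) (pos α a) p ⊎ From-e p)
      either? p = before? (not b) (pos α a) p ⊎-dec from-e? p
      split-at-e : countBefore b n ≤ countBefore b (pos α e) + count from-e?
      split-at-e = count-cover (before? b (pos α e)) from-e? (before? b n) cover
        where
        cover : ∀ {p} → Before b n p → Before b (pos α e) p ⊎ From-e p
        cover {p} (_ , pb) with toℕ p <? pos α e
        ... | yes p<e = inj₁ (p<e , pb)
        ... | no p≮e  = inj₂ (≮⇒≥ p≮e , pb)
      disjoint : ∀ {p} → Before (not b) (pos α a) p → From-e p → ⊥
      disjoint (_ , p¬b) (_ , pb) = not-¬ pb p¬b
      jumped : ∀ {p} → Before (not b) (pos α a) p ⊎ From-e p → JumpedIn p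
      jumped {p} (inj₁ (p<a , p¬b)) = jumped-between la (leftmost-≤ l-left p) (<⇒≤ p<a) (trans p¬b (cong not (sym cl≡b)))
      jumped {p} (inj₂ (e≤p , pb))  = jumped-between er e≤p (≤-rightmost r-right p)
                                         (trans pb (trans (sym (not-involutive b)) (cong not (sym ce≡¬b))))
      all-jumped : B-a + count from-e? ≤ jumpSum
      all-jumped = ≤-trans (count-disjoint (before? (not b) (pos α a)) from-e? either? disjoint id)
                           (count-≤-jumpSum either? jumped)

module Bridge {n : ℕ} (G : Graph n) (x y : Fin n) (xy : adj G x y ≡ true)
              (connected : Connected G) (disconnected : ¬ Connected (removeEdge G x y)) where

  H : Graph n
  H = removeEdge G x y

  end : Bool → Fin n
  end true  = x
  end false = y

  reaches-an-end : ∀ {u v} → Reach G u v → Reach H u v ⊎ Reach H x v ⊎ Reach H y v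
  reaches-an-end here = inj₁ here
  reaches-an-end (step {u} {t} ut tv) with reaches-an-end tv
  ... | inj₂ from-end = inj₂ from-end
  ... | inj₁ H-tv with ((u Fin.≟ x) ×-dec (t Fin.≟ y)) ⊎-dec ((u Fin.≟ y) ×-dec (t Fin.≟ x))
  ...   | yes (inj₁ (_ , refl)) = inj₂ (inj₂ H-tv)
  ...   | yes (inj₂ (_ , refl)) = inj₂ (inj₁ H-tv)
  ...   | no other = inj₁ (step (trans (removeEdge-keeps G x y other) ut) H-tv)

  component : ∀ v → Reach H x v ⊎ Reach H y v
  component v with reaches-an-end (connected x v)
  ... | inj₁ xv       = inj₁ xv
  ... | inj₂ from-end = from-end

  not-both : ∀ {v} → Reach H x v → Reach H y v → ⊥
  not-both xv yv = disconnected λ u w → Reach-trans (Reach-sym (from-x u)) (from-x w)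
    where
    from-x : ∀ v → Reach H x v
    from-x v = [ id , Reach-trans (Reach-trans xv (Reach-sym yv)) ]′ (component v)

  side : Fin n → Bool
  side v with component v
  ... | inj₁ _ = true
  ... | inj₂ _ = false

  reach-from-side : ∀ v → Reach H (end (side v)) v
  reach-from-side v with component v
  ... | inj₁ xv = xv
  ... | inj₂ yv = yv

  side-reached : ∀ {b v} → Reach H (end b) v → side v ≡ b
  side-reached {b} {v} r with component v
  side-reached {true}  r | inj₁ _  = refl
  side-reached {false} r | inj₁ xv = ⊥-elim (not-both xv r)
  side-reached {true}  r | inj₂ yv = ⊥-elim (not-both r yv)
  side-reached {false} r | inj₂ _  = refl

  side-end : ∀ b → side (end b) ≡ b
  side-end b = side-reached here

  H-monochromatic : ∀ {u v} → adj H u v ≡ true → side u ≡ side v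
  H-monochromatic {u} uv = sym (side-reached (Reach-snoc (reach-from-side u) uv))

  same-side-reach : ∀ {u v} → side u ≡ side v → Reach H u v
  same-side-reach {u} {v} uv = Reach-trans (Reach-sym (reach-from-side u)) (subst (λ b → Reach H (end b) v) (sym uv) (reach-from-side v))

  cost-split : ∀ b γ → cost γ G ≡ ∣ pos γ (end b) - pos γ (end (not b)) ∣ + edgeSum H (λ u v → ∣ pos γ u - pos γ v ∣)
  cost-split true  γ = edgeSum-removeEdge G x y (∣-∣-comm (pos γ y) (pos γ x)) xy
  cost-split false γ =
    trans (cost-split true γ) (cong (_+ edgeSum H (λ u v → ∣ pos γ u - pos γ v ∣)) (∣-∣-comm (pos γ x) (pos γ y)))

  netCost-H-≤ : ∀ γ → netCost γ H ≤ netCost γ G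
  netCost-H-≤ γ = ≤-trans (m≤n+m _ _)
    (≤-reflexive (sym (edgeSum-removeEdge G x y (cong (_∸ 1) (∣-∣-comm (pos γ y) (pos γ x))) xy)))

  module _ (α : Arrangement n) where

    open Positions α
    open Colouring α side
    open Walks H H-monochromatic

    one-sided⇒netCost>k : ∀ {k b l r} → Leftmost l → Rightmost r → side l ≡ b → side r ≡ b →
                          MoreThan k (λ v → side v ≡ not b) → k < netCost α G
    one-sided⇒netCost>k {k} {b} {l} l-left r-right sl sr large = begin-strict
      k                          <⟨ moreThan-<-countColour large ⟩
      countColour (not b)        ≡⟨ cong (countColour ∘ not) sl ⟨
      countColour (not (side l)) ≤⟨ countColour-≤-jumpSum l-left r-right (same-side-reach (trans sl (sym sr))) ⟩
      jumpSum                    ≤⟨ jumpSum-≤-netCost ⟩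
      netCost α H                ≤⟨ netCost-H-≤ α ⟩
      netCost α G                ∎
      where open ≤-Reasoning

    extremes⇒cheaper : ∀ {b l r a f} → Leftmost l → Rightmost r → side l ≡ b → side r ≡ not b →
                       side a ≡ b → side f ≡ not b → pos α f < pos α a →
                       pos α f ≤ pos α (end (not b)) → pos α (end b) ≤ pos α a →
                       cost (Grouped.grouped b) G < cost α G
    extremes⇒cheaper {b} {l} {r} {a} {f} l-left r-right sl sr sa sf f<a f≤e′ e≤a = begin-strict
      cost grouped G                                                   ≡⟨ cost-split b grouped ⟩
      ∣ pos grouped e - pos grouped e′ ∣ + edgeSum H (λ s t → ∣ pos grouped s - pos grouped t ∣)
        ≡⟨ cong₂ _+_ (ranks e e′) (edgeSum-cong H (λ {s} {t} _ _ → ranks s t)) ⟩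
      ∣ rank e - rank e′ ∣ + edgeSum H (λ s t → ∣ rank s - rank t ∣)  <⟨ +-monoˡ-< _ bridge-shorter ⟩
      S + d + edgeSum H (λ s t → ∣ rank s - rank t ∣)                  ≡⟨ xy∙z≈y∙zx S d _ ⟩
      d + (edgeSum H (λ s t → ∣ rank s - rank t ∣) + S)                ≤⟨ +-monoʳ-≤ d H-shorter ⟩
      d + edgeSum H (λ s t → ∣ pos α s - pos α t ∣)                    ≡⟨ cost-split b α ⟨
      cost α G                                                         ∎
      where
      open ≤-Reasoning
      open Grouped b
      S : ℕ
      S = jumpSum
      e e′ : Fin n
      e  = end b
      e′ = end (not b)
      d : ℕ
      d = ∣ pos α e - pos α e′ ∣
      A B : ℕ → ℕ
      A = countBefore b
      B = countBefore (not b)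
      ranks : ∀ s t → ∣ pos grouped s - pos grouped t ∣ ≡ ∣ rank s - rank t ∣
      ranks s t = cong₂ ∣_-_∣ (pos-grouped s) (pos-grouped t)
      H-shorter : edgeSum H (λ s t → ∣ rank s - rank t ∣) + S ≤ edgeSum H (λ s t → ∣ pos α s - pos α t ∣)
      H-shorter = ≤-trans (≤-reflexive (sym (edgeSum-+ H _ _)))
                          (edgeSum-mono H (λ s<t st → grouped-shortens (H-monochromatic st) (Finₚ.<⇒≢ s<t)))
      counted : A n + B (pos α e′) + A (pos α f) < S + d + A (pos α e) + A (pos α f)
      counted = begin-strict
        A n + B (pos α e′) + A (pos α f)        ≡⟨ +-assoc (A n) (B (pos α e′)) (A (pos α f)) ⟩
        A n + (B (pos α e′) + A (pos α f))      <⟨ +-monoʳ-< (A n) (stretch-bound sa (side-end (not b)) f<a f≤e′ e≤a) ⟩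
        A n + (B (pos α a) + d + A (pos α e))   ≡⟨ cong (A n +_) (+-assoc (B (pos α a)) d (A (pos α e))) ⟩
        A n + (B (pos α a) + (d + A (pos α e))) ≡⟨ x∙yz≈yx∙z (A n) (B (pos α a)) (d + A (pos α e)) ⟩
        B (pos α a) + A n + (d + A (pos α e))   ≤⟨ +-monoˡ-≤ (d + A (pos α e)) (jumpSum-lower-bound l-left r-right sl sf
                                                     (same-side-reach (trans sl (sym sa))) (same-side-reach (trans sf (sym sr)))) ⟩
        S + A (pos α f) + (d + A (pos α e))     ≡⟨ +-interchange S (A (pos α f)) d (A (pos α e)) ⟩
        S + d + (A (pos α f) + A (pos α e))     ≡⟨ cong (S + d +_) (+-comm (A (pos α f)) (A (pos α e))) ⟩
        S + d + (A (pos α e) + A (pos α f))     ≡⟨ +-assoc (S + d) (A (pos α e)) (A (pos α f)) ⟨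
        S + d + A (pos α e) + A (pos α f)       ∎
      bridge-shorter : ∣ rank e - rank e′ ∣ < S + d
      bridge-shorter = +-cancelʳ-< (A (pos α e)) _ _ (begin-strict
        ∣ rank e - rank e′ ∣ + A (pos α e) ≡⟨ grouped-stretch (side-end b) (side-end (not b)) ⟩
        A n + B (pos α e′)                  <⟨ +-cancelʳ-< (A (pos α f)) _ _ counted ⟩
        S + d + A (pos α e)                 ∎)

    interleaved⇒cheaper : ∀ {b l r u v} → Leftmost l → Rightmost r → side l ≡ b → side r ≡ not b →
                          side u ≡ not b → side v ≡ b → pos α u < pos α v → cost (Grouped.grouped b) G < cost α G
    interleaved⇒cheaper {b} l-left r-right sl sr su sv u<v =
      let (a , sa , v≤a , e≤a) = later {P = λ w → side w ≡ b} sv (side-end b)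
          (f , sf , f≤u , f≤e′) = earlier {P = λ w → side w ≡ not b} su (side-end (not b))
      in extremes⇒cheaper l-left r-right sl sr sa sf (≤-<-trans f≤u (<-≤-trans u<v v≤a)) f≤e′ e≤a

    optimal⇒sides-ordered : Optimal G α → ∀ {b l r} → Leftmost l → Rightmost r → side l ≡ b → side r ≡ not b →
                            ∀ {u v} → side u ≡ b → side v ≡ not b → pos α u < pos α v
    optimal⇒sides-ordered optimal l-left r-right sl sr {u} {v} su sv with <-cmp (pos α u) (pos α v)
    ... | tri< u<v _ _ = u<v
    ... | tri≈ _ u≡v _ = contradiction (trans (sym su) (trans (cong side (pos-injective u≡v)) sv)) (not-¬ refl)
    ... | tri> _ _ v<u = contradiction (optimal (Grouped.grouped _)) (<⇒≱ (interleaved⇒cheaper l-left r-right sl sr sv su v<u))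

lemma2p3 : ∀ {n : ℕ} (G : Graph n) (k : ℕ) → 1 ≤ k
         → Connected G
         → (∀ (m : ℕ) → IsOlaPlus G m → m ≤ k)
         → ∀ (α : Arrangement n) → Optimal G α
         → ∀ (x y : Fin n) → KSeparatingBridge k G x y
         → Comparable α (Reach (removeEdge G x y) x) (Reach (removeEdge G x y) y)
lemma2p3 {n} G k _ connected ola⁺≤k α optimal x y ((xy , disconnected) , (fx , fx-inj , fx-in) , (fy , fy-inj , fy-in)) =
  by-end-sides (side l) (side r) refl refl
  where
  open Bridge G x y xy connected disconnected
  open Positions α
  l r : Fin n
  l = proj₁ (leftmost x)
  r = proj₁ (rightmost x)
  l-left : Leftmost l
  l-left = proj₂ (leftmost x)
  r-right : Rightmost r
  r-right = proj₂ (rightmost x)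
  netCost≤k : netCost α G ≤ k
  netCost≤k = ola⁺≤k _ (optimal⇒isOlaPlus G {α} optimal)
  by-end-sides : ∀ bl br → side l ≡ bl → side r ≡ br → Comparable α (Reach H x) (Reach H y)
  by-end-sides true  true  sl sr = contradiction netCost≤k
    (<⇒≱ (one-sided⇒netCost>k α l-left r-right sl sr (fy , fy-inj , side-reached ∘ fy-in)))
  by-end-sides false false sl sr = contradiction netCost≤k
    (<⇒≱ (one-sided⇒netCost>k α l-left r-right sl sr (fx , fx-inj , side-reached ∘ fx-in)))
  by-end-sides true  false sl sr = inj₁ λ a b xa yb →
    optimal⇒sides-ordered α optimal l-left r-right sl sr (side-reached xa) (side-reached yb)
  by-end-sides false true  sl sr = inj₂ λ a b xa yb →
    optimal⇒sides-ordered α optimal l-left r-right sl sr (side-reached yb) (side-reached xa)
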